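{- Let $G$ be a connected graph of order $n\geq 2$ and let $H$ be a graph with $k\geq 1$ connected components $H_1,\ldots,H_k$. Then $\chi_L(G\odot H)\geq \max\{\chi_L(H_t+K_1): 1\leq t\leq k\}$.
   Context: All graphs are finite and simple. For a connected graph $G$, a $k$-coloring is a map $c:V(G)\to\{1,\ldots,k\}$ with $c(u)\neq c(v)$ whenever $uv\in E(G)$; it induces the partition $\Pi=\{C_1,\ldots,C_k\}$ into color classes. The color code of $v$ is $c_\Pi(v)=(d(v,C_1),\ldots,d(v,C_k))$, where $d(v,C_i)=\min\{d(v,x): x\in C_i\}$. The coloring is locating if distinct vertices have distinct color codes; $\chi_L(G)$ is the least $k$ admitting a locating $k$-coloring. The corona product $G\odot H$ (for $V(G)=\{a_1,\ldots,a_n\}$) is obtained from one copy of $G$ and $n$ copies of $H$ by joining $a_i$ to every vertex of the $i$-th copy of $H$. $H_t+K_1$ denotes the join of $H_t$ with a single new vertex adjacent to all vertices of $H_t$. -}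

module Defs where

open import Data.Nat using (ℕ; zero; suc; _≤_; _<_)
open import Data.Fin using (Fin; zero; suc; _≟_)
open import Data.Bool using (Bool; true; false; _∧_)
open import Data.Bool.Properties using (∧-comm)
open import Data.Sum using (_⊎_; inj₁; inj₂)
open import Data.Product using (Σ; ∃; _×_; _,_)
open import Relation.Nullary using (¬_)
open import Relation.Nullary.Decidable using (⌊_⌋)
open import Relation.Binary.PropositionalEquality using (_≡_; refl; sym; cong; cong₂; _≢_)
open import Function.Definitions using (Injective)

record Graph (V : Set) : Set where
  field
    adj     : V → V → Bool
    adj-sym : ∀ u v → adj u v ≡ adj v u
    adj-irr : ∀ v → adj v v ≡ false
open Graph public using (adj; adj-sym; adj-irr)

data Walk {V : Set} (G : Graph V) : V → V → ℕ → Set where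
  here : ∀ {v} → Walk G v v 0
  step : ∀ {u w v l} → adj G u w ≡ true → Walk G w v l → Walk G u v (suc l)

Connected : {V : Set} → Graph V → Set
Connected G = ∀ u v → ∃ λ l → Walk G u v l

-- k-colorings: proper maps into Fin k; every color class nonempty
-- (so that the coloring induces a partition into k color classes).
record Coloring {V : Set} (G : Graph V) (k : ℕ) : Set where
  field
    col      : V → Fin k
    proper   : ∀ u v → adj G u v ≡ true → col u ≢ col v
    surj     : ∀ i → ∃ λ v → col v ≡ i
open Coloring public

DistToClass : {V : Set} {G : Graph V} {k : ℕ} → Coloring G k → V → Fin k → ℕ → Set
DistToClass {V} {G} c v i m =
  (∃ λ x → col c x ≡ i × Walk G v x m) ×
  (∀ x l → col c x ≡ i → Walk G v x l → m ≤ l)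

SameCode : {V : Set} {G : Graph V} {k : ℕ} → Coloring G k → V → V → Set
SameCode c u w = ∀ i m → (DistToClass c u i m → DistToClass c w i m)
                       × (DistToClass c w i m → DistToClass c u i m)

Locating : {V : Set} {G : Graph V} {k : ℕ} → Coloring G k → Set
Locating {V} c = ∀ (u w : V) → SameCode c u w → u ≡ w

IsLocChromNum : {V : Set} → Graph V → ℕ → Set
IsLocChromNum G k =
  (Σ (Coloring G k) Locating) × (∀ j → j < k → ¬ Σ (Coloring G j) Locating)

-- Corona product G ⊙ H: vertices inj₁ a (the copy of G) and inj₂ (i , h)
-- (vertex h of the i-th copy of H).
coronaAdj : ∀ {n m} → Graph (Fin n) → Graph (Fin m) →
            Fin n ⊎ (Fin n × Fin m) → Fin n ⊎ (Fin n × Fin m) → Bool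
coronaAdj G H (inj₁ a) (inj₁ b) = adj G a b
coronaAdj G H (inj₁ a) (inj₂ (i , h)) = ⌊ a ≟ i ⌋
coronaAdj G H (inj₂ (i , h)) (inj₁ a) = ⌊ i ≟ a ⌋
coronaAdj G H (inj₂ (i , h)) (inj₂ (j , h')) = ⌊ i ≟ j ⌋ ∧ adj H h h'

private
  ≟-sym : ∀ {n} (a b : Fin n) → ⌊ a ≟ b ⌋ ≡ ⌊ b ≟ a ⌋
  ≟-sym a b with a ≟ b | b ≟ a
  ... | Relation.Nullary.yes _ | Relation.Nullary.yes _ = refl
  ... | Relation.Nullary.no _ | Relation.Nullary.no _ = refl
  ... | Relation.Nullary.yes p | Relation.Nullary.no q with q (sym p)
  ... | ()
  ≟-sym a b | Relation.Nullary.no q | Relation.Nullary.yes p with q (sym p)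
  ... | ()

  coronaSym : ∀ {n m} (G : Graph (Fin n)) (H : Graph (Fin m)) u v →
              coronaAdj G H u v ≡ coronaAdj G H v u
  coronaSym G H (inj₁ a) (inj₁ b) = adj-sym G a b
  coronaSym G H (inj₁ a) (inj₂ (i , h)) = ≟-sym a i
  coronaSym G H (inj₂ (i , h)) (inj₁ a) = ≟-sym i a
  coronaSym G H (inj₂ (i , h)) (inj₂ (j , h')) = cong₂ _∧_ (≟-sym i j) (adj-sym H h h')

  ∧-false : ∀ b → b ∧ false ≡ false
  ∧-false false = refl
  ∧-false true = refl

  coronaIrr : ∀ {n m} (G : Graph (Fin n)) (H : Graph (Fin m)) v →
              coronaAdj G H v v ≡ false
  coronaIrr G H (inj₁ a) = adj-irr G a
  coronaIrr G H (inj₂ (i , h)) rewrite adj-irr H h = ∧-false ⌊ i ≟ i ⌋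

_⊙_ : ∀ {n m} → Graph (Fin n) → Graph (Fin m) → Graph (Fin n ⊎ (Fin n × Fin m))
G ⊙ H = record { adj = coronaAdj G H ; adj-sym = coronaSym G H ; adj-irr = coronaIrr G H }

-- K + K₁: the new vertex is zero, the vertex x of K is suc x.
joinAdj : ∀ {p} → Graph (Fin p) → Fin (suc p) → Fin (suc p) → Bool
joinAdj K zero zero = false
joinAdj K zero (suc y) = true
joinAdj K (suc x) zero = true
joinAdj K (suc x) (suc y) = adj K x y

private
  joinSym : ∀ {p} (K : Graph (Fin p)) u v → joinAdj K u v ≡ joinAdj K v u
  joinSym K zero zero = refl
  joinSym K zero (suc y) = refl
  joinSym K (suc x) zero = refl
  joinSym K (suc x) (suc y) = adj-sym K x y

  joinIrr : ∀ {p} (K : Graph (Fin p)) v → joinAdj K v v ≡ false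
  joinIrr K zero = refl
  joinIrr K (suc x) = adj-irr K x

_+K₁ : ∀ {p} → Graph (Fin p) → Graph (Fin (suc p))
K +K₁ = record { adj = joinAdj K ; adj-sym = joinSym K ; adj-irr = joinIrr K }

record IsComponent {m p : ℕ} (H : Graph (Fin m)) (K : Graph (Fin p))
                   (e : Fin p → Fin m) : Set where
  field
    nonempty  : 1 ≤ p
    injective : Injective _≡_ _≡_ e
    induced   : ∀ x y → adj K x y ≡ adj H (e x) (e y)
    closed    : ∀ x v → adj H (e x) v ≡ true → ∃ λ y → e y ≡ v
    connected : Connected K

-- Let a be a vertex of G. Together with the copy of the component K in the
-- copy of H attached to a, it induces a copy of K + K₁ in G ⊙ H, and the
-- restriction of a locating colouring of G ⊙ H to it is again locating.
-- Indeed, from a vertex x of the copy of K, colour classes at distance at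
-- most 1 are seen inside K + K₁ (so they are determined by the code of x in
-- K + K₁), while a walk of length at least 2 from x can be replaced by one
-- of at most the same length through a, which is adjacent to every vertex of
-- the copy. Dropping the colours that the restriction misses leaves a
-- locating colouring of K + K₁ with at most χ_L(G ⊙ H) colours.
module Submission where

open import Defs
open import Data.Nat using (ℕ; zero; suc; _≤_; z≤n; s≤s)
open import Data.Nat.Properties using (≤-trans; ≤-refl; ≤-antisym; ≮⇒≥; m≤n⇒m≤1+n)
open import Data.Fin using (Fin; zero; suc; _≟_; punchOut)
open import Data.Fin.Properties using (punchOut-injective; punchOut-cong; any?; all?; ¬∀⟶∃¬)
open import Data.Bool using (true)
open import Data.Sum using (_⊎_; inj₁; inj₂)
open import Data.Sum.Properties using (inj₂-injective)
open import Data.Product using (∃; Σ; _×_; _,_; proj₁; proj₂; swap)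
open import Data.Product.Properties using (,-injectiveʳ)
open import Data.Empty using (⊥-elim)
open import Relation.Nullary using (yes; no)
open import Relation.Nullary.Decidable using (⌊_⌋; isYes≗does; dec-true)
open import Relation.Binary.PropositionalEquality using (_≡_; refl; sym; trans; cong; subst; _≢_)

-- Colour codes of arbitrary (not necessarily surjective) colour maps;
-- for a colouring c, ClassDist G (col c) is definitionally DistToClass c.
ClassDist : {V : Set} (G : Graph V) {k : ℕ} → (V → Fin k) → V → Fin k → ℕ → Set
ClassDist G cl v i m =
  (∃ λ x → cl x ≡ i × Walk G v x m) ×
  (∀ x l → cl x ≡ i → Walk G v x l → m ≤ l)

SameCodeUnder : {V : Set} (G : Graph V) {k : ℕ} → (V → Fin k) → V → V → Set
SameCodeUnder G cl u w = ∀ i m → (ClassDist G cl u i m → ClassDist G cl w i m)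
                               × (ClassDist G cl w i m → ClassDist G cl u i m)

LocatingMap : {V : Set} (G : Graph V) {k : ℕ} → (V → Fin k) → Set
LocatingMap {V} G cl = ∀ (u w : V) → SameCodeUnder G cl u w → u ≡ w

ProperMap : {V : Set} (G : Graph V) {k : ℕ} → (V → Fin k) → Set
ProperMap G cl = ∀ u v → adj G u v ≡ true → cl u ≢ cl v

ClassWithin : {V : Set} (G : Graph V) {k : ℕ} → (V → Fin k) → V → Fin k → ℕ → Set
ClassWithin G cl v i l = ∃ λ z → ∃ λ l′ → l′ ≤ l × cl z ≡ i × Walk G v z l′

module _ {V : Set} {G : Graph V} {k : ℕ} {cl : V → Fin k} where

  walk-length-0 : ∀ {u v} → Walk G u v 0 → u ≡ v
  walk-length-0 here = refl

  sameCode-sym : ∀ {u w} → SameCodeUnder G cl u w → SameCodeUnder G cl w u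
  sameCode-sym sc i m = swap (sc i m)

  classDist-0 : ∀ v → ClassDist G cl v (cl v) 0
  classDist-0 v = (v , refl , here) , λ _ _ _ _ → z≤n

  sameCode⇒sameColour : ∀ {u w} → SameCodeUnder G cl u w → cl u ≡ cl w
  sameCode⇒sameColour {u} sc with proj₁ (sc (cl u) 0) (classDist-0 u)
  ... | (x , cx , W) , _ rewrite walk-length-0 W = sym cx

  classDist⇒classWithin : ∀ {v i m} → ClassDist G cl v i m → ClassWithin G cl v i m
  classDist⇒classWithin ((x , cx , W) , _) = x , _ , ≤-refl , cx , W

  -- Restricted to l ≤ 1: only there is the minimality of the distance evident.
  sameCode-within₁ : ∀ {u w z i l} → SameCodeUnder G cl u w →
                     Walk G u z l → l ≤ 1 → cl z ≡ i → ClassWithin G cl w i l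
  sameCode-within₁ {u} {i = i} sc W l≤1 cz with cl u ≟ i
  ... | yes refl with classDist⇒classWithin (proj₁ (sc (cl u) 0) (classDist-0 u))
  ...   | z′ , _ , z≤n , cz′ , W′ = z′ , 0 , z≤n , cz′ , W′
  sameCode-within₁ sc here _ refl | no u≢i = ⊥-elim (u≢i refl)
  sameCode-within₁ sc (step _ (step _ _)) (s≤s ()) _ | no _
  sameCode-within₁ {u} {z = z} {i} sc (step ad here) _ cz | no u≢i =
    classDist⇒classWithin (proj₁ (sc i 1) ((z , cz , step ad here) , atLeast1))
    where
    atLeast1 : ∀ x l → cl x ≡ i → Walk G u x l → 1 ≤ l
    atLeast1 x zero cx here = ⊥-elim (u≢i cx)
    atLeast1 x (suc l) _ _ = s≤s z≤n

  classDist-transfer : ∀ {u w i} →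
    (∀ {z l} → cl z ≡ i → Walk G u z l → ClassWithin G cl w i l) →
    (∀ {z l} → cl z ≡ i → Walk G w z l → ClassWithin G cl u i l) →
    ∀ {m} → ClassDist G cl u i m → ClassDist G cl w i m
  classDist-transfer {w = w} u→w w→u {m} ((z , cz , W) , u-min)
    with u→w cz W
  ... | z′ , l′ , l′≤m , cz′ , W′ =
    (z′ , cz′ , subst (Walk G w z′) (≤-antisym l′≤m (w-min z′ l′ cz′ W′)) W′) , w-min
    where
    w-min : ∀ x l → cl x ≡ _ → Walk G w x l → m ≤ l
    w-min x l cx W″ with w→u cx W″
    ... | _ , l″ , l″≤l , cz″ , W‴ = ≤-trans (u-min _ l″ cz″ W‴) l″≤l

classDist-cong : ∀ {V} {G : Graph V} {k k′} {cl : V → Fin k} {cl′ : V → Fin k′} {i j} →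
                 (∀ x → cl x ≡ i → cl′ x ≡ j) → (∀ x → cl′ x ≡ j → cl x ≡ i) →
                 ∀ {v m} → ClassDist G cl v i m → ClassDist G cl′ v j m
classDist-cong to from ((x , cx , W) , v-min) =
  (x , to x cx , W) , λ x′ l cx′ W′ → v-min x′ l (from x′ cx′) W′

mapWalk : ∀ {V W} {G : Graph V} {G′ : Graph W} (f : V → W) →
          (∀ u v → adj G u v ≡ true → adj G′ (f u) (f v) ≡ true) →
          ∀ {u v l} → Walk G u v l → Walk G′ (f u) (f v) l
mapWalk f f-adj here = here
mapWalk f f-adj (step ad W) = step (f-adj _ _ ad) (mapWalk f f-adj W)

module WithoutColour {V : Set} {G : Graph V} {a : ℕ} {cl : V → Fin (suc a)}
                     {i : Fin (suc a)} (unused : ∀ v → i ≢ cl v) where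

  recolour : V → Fin a
  recolour v = punchOut (unused v)

  recolour-proper : ProperMap G cl → ProperMap G recolour
  recolour-proper proper u v ad eq =
    proper u v ad (punchOut-injective (unused u) (unused v) eq)

  recolour-locating : LocatingMap G cl → LocatingMap G recolour
  recolour-locating loc u w sc = loc u w sameCode
    where
    sameCode : SameCodeUnder G cl u w
    sameCode i′ m with i ≟ i′
    ... | yes refl = (λ { ((x , cx , _) , _) → ⊥-elim (unused x (sym cx)) })
                   , (λ { ((x , cx , _) , _) → ⊥-elim (unused x (sym cx)) })
    ... | no i≢i′ = (λ d → back (proj₁ (sc j m) (forth d)))
                  , (λ d → back (proj₂ (sc j m) (forth d)))
      where
      j = punchOut i≢i′
      to : ∀ x → cl x ≡ i′ → recolour x ≡ j
      to x eq = punchOut-cong i eq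
      from : ∀ x → recolour x ≡ j → cl x ≡ i′
      from x eq = punchOut-injective (unused x) i≢i′ eq
      forth : ∀ {v} → ClassDist G cl v i′ m → ClassDist G recolour v j m
      forth = classDist-cong to from
      back : ∀ {v} → ClassDist G recolour v j m → ClassDist G cl v i′ m
      back = classDist-cong from to

locatingColouring-≤ : ∀ {q} (G : Graph (Fin q)) (a : ℕ) (cl : Fin q → Fin a) →
                      ProperMap G cl → LocatingMap G cl →
                      ∃ λ j → j ≤ a × Σ (Coloring G j) Locating
locatingColouring-≤ G a cl proper loc
  with all? (λ i → any? (λ v → cl v ≟ i))
... | yes onto = a , ≤-refl , record { col = cl ; proper = proper ; surj = onto } , loc
locatingColouring-≤ G zero cl proper loc | no ¬onto = ⊥-elim (¬onto λ ())
locatingColouring-≤ G (suc a) cl proper loc | no ¬onto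
  with ¬∀⟶∃¬ (suc a) _ (λ i → any? (λ v → cl v ≟ i)) ¬onto
... | i , missed with locatingColouring-≤ G a recolour
                        (recolour-proper proper) (recolour-locating loc)
  where open WithoutColour {G = G} (λ v eq → missed (v , sym eq))
...   | j , j≤a , coloring = j , m≤n⇒m≤1+n j≤a , coloring

locChromNum-≤ : ∀ {q} {G : Graph (Fin q)} {a b : ℕ} {cl : Fin q → Fin a} →
                IsLocChromNum G b → ProperMap G cl → LocatingMap G cl → b ≤ a
locChromNum-≤ {G = G} {a} {cl = cl} (_ , minimal) proper loc
  with locatingColouring-≤ G a cl proper loc
... | j , j≤a , coloring = ≤-trans (≮⇒≥ λ j<b → minimal j j<b coloring) j≤a

≟-refl : ∀ {n} (i : Fin n) → ⌊ i ≟ i ⌋ ≡ true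
≟-refl i = trans (isYes≗does (i ≟ i)) (dec-true (i ≟ i) refl)

module ComponentCopy {n m p : ℕ} (G : Graph (Fin n)) (H : Graph (Fin m))
                     (K : Graph (Fin p)) (e : Fin p → Fin m) (K-comp : IsComponent H K e)
                     (a₀ : Fin n) where
  open IsComponent K-comp

  embed : Fin (suc p) → Fin n ⊎ (Fin n × Fin m)
  embed zero = inj₁ a₀
  embed (suc x) = inj₂ (a₀ , e x)

  embed-adj : ∀ u v → adj (K +K₁) u v ≡ true → adj (G ⊙ H) (embed u) (embed v) ≡ true
  embed-adj zero zero ()
  embed-adj zero (suc y) _ = ≟-refl a₀
  embed-adj (suc x) zero _ = ≟-refl a₀
  embed-adj (suc x) (suc y) ad rewrite ≟-refl a₀ = trans (sym (induced x y)) ad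

  embed-walk : ∀ {u v l} → Walk (K +K₁) u v l → Walk (G ⊙ H) (embed u) (embed v) l
  embed-walk = mapWalk embed embed-adj

  embed-injective : ∀ {x y} → embed (suc x) ≡ embed (suc y) → x ≡ y
  embed-injective eq = injective (,-injectiveʳ (inj₂-injective eq))

  neighbour-of-copy : ∀ x {z} → adj (G ⊙ H) (embed (suc x)) z ≡ true →
                      ∃ λ u → z ≡ embed u × adj (K +K₁) (suc x) u ≡ true
  neighbour-of-copy x {inj₁ b} ad with a₀ ≟ b
  ... | yes refl = zero , refl , refl
  neighbour-of-copy x {inj₁ b} () | no _
  neighbour-of-copy x {inj₂ (j , h)} ad with a₀ ≟ j
  ... | yes refl with closed x h ad
  ...   | y , refl = suc y , refl , trans (induced x y) ad
  neighbour-of-copy x {inj₂ (j , h)} () | no _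

  walk-from-copy : ∀ x {z k} → Walk (G ⊙ H) (embed (suc x)) z (suc k) →
                   (∃ λ l → l ≤ k × Walk (G ⊙ H) (embed zero) z l) ⊎ (∃ λ y → z ≡ embed (suc y))
  walk-from-copy x (step {w = w} ad W) with neighbour-of-copy x {w} ad
  ... | zero , refl , _ = inj₁ (_ , ≤-refl , W)
  ... | suc y , refl , _ with W
  ...   | here = inj₂ (y , refl)
  ...   | W′@(step _ _) with walk-from-copy y W′
  ...     | inj₁ (l , l≤k , W″) = inj₁ (l , m≤n⇒m≤1+n l≤k , W″)
  ...     | inj₂ inCopy = inj₂ inCopy

  module _ {k : ℕ} (cl : Fin n ⊎ (Fin n × Fin m) → Fin k) where

    restriction : Fin (suc p) → Fin k
    restriction v = cl (embed v)

    embed-within : ∀ {v i l} → ClassWithin (K +K₁) restriction v i l →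
                   ClassWithin (G ⊙ H) cl (embed v) i l
    embed-within (z , l′ , l′≤l , cz , W) = embed z , l′ , l′≤l , cz , embed-walk W

    within-transfer : ∀ {x y z i l} → SameCodeUnder (K +K₁) restriction (suc x) (suc y) →
                      cl z ≡ i → Walk (G ⊙ H) (embed (suc x)) z l →
                      ClassWithin (G ⊙ H) cl (embed (suc y)) i l
    within-transfer sc cz here = embed-within (sameCode-within₁ sc here z≤n cz)
    within-transfer {x} sc cz (step {w = w} ad here) with neighbour-of-copy x {w} ad
    ... | u , refl , adu = embed-within (sameCode-within₁ sc (step adu here) ≤-refl cz)
    within-transfer {x} {z = z} sc cz W@(step _ (step _ _)) with walk-from-copy x W
    ... | inj₁ (l , l≤k , W′) = z , suc l , s≤s l≤k , cz , step (≟-refl a₀) W′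
    ... | inj₂ (_ , refl) =
      z , 2 , s≤s (s≤s z≤n) , cz , embed-walk (step {w = zero} refl (step refl here))

    sameCode-lift : ∀ {x y} → SameCodeUnder (K +K₁) restriction (suc x) (suc y) →
                    SameCodeUnder (G ⊙ H) cl (embed (suc x)) (embed (suc y))
    sameCode-lift sc i m =
      classDist-transfer (within-transfer sc) (within-transfer (sameCode-sym sc)) ,
      classDist-transfer (within-transfer (sameCode-sym sc)) (within-transfer sc)

    restriction-proper : ProperMap (G ⊙ H) cl → ProperMap (K +K₁) restriction
    restriction-proper proper u v ad = proper (embed u) (embed v) (embed-adj u v ad)

    restriction-locating : ProperMap (G ⊙ H) cl → LocatingMap (G ⊙ H) cl →
                           LocatingMap (K +K₁) restriction
    restriction-locating proper loc u w sc = by-cases u w sc (sameCode⇒sameColour sc)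
      where
      by-cases : ∀ u w → SameCodeUnder (K +K₁) restriction u w →
                 restriction u ≡ restriction w → u ≡ w
      by-cases zero zero _ _ = refl
      by-cases zero (suc y) _ eq = ⊥-elim (restriction-proper proper zero (suc y) refl eq)
      by-cases (suc x) zero _ eq = ⊥-elim (restriction-proper proper (suc x) zero refl eq)
      by-cases (suc x) (suc y) sc _ =
        cong suc (embed-injective (loc _ _ (sameCode-lift sc)))

lemma3 : (n m : ℕ) (G : Graph (Fin n)) (H : Graph (Fin m)) →
         2 ≤ n → Connected G → 1 ≤ m →
         (p : ℕ) (K : Graph (Fin p)) (e : Fin p → Fin m) → IsComponent H K e →
         (a b : ℕ) → IsLocChromNum (G ⊙ H) a → IsLocChromNum (K +K₁) b →
         b ≤ a
lemma3 (suc n) m G H _ _ _ p K e K-comp a b ((c , c-locating) , _) χ-b =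
  locChromNum-≤ χ-b (restriction-proper (col c) (proper c))
                    (restriction-locating (col c) (proper c) c-locating)
  where open ComponentCopy G H K e K-comp zero
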